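{- Let $G$ be a graph of order $n\ge 2$ and let $H$ be a graph with at least two vertices and root vertex $v$. Then: (i) If every $\gamma_R(H)$-function $f$ satisfies $f(v)=0$, then $\gamma_R(G\circ H)=n\gamma_R(H)$. (ii) If there exist two $\gamma_R(H)$-functions $h$ and $h'$ with $h(v)=1$ and $h'(v)=2$, then $\gamma_R(G\circ H)=n(\gamma_R(H)-1)+\gamma(G)$.
   Context: All graphs are finite, simple and undirected. $\gamma(G)$ is the domination number. A Roman dominating function on $G=(V,E)$ is a map $f:V\to\{0,1,2\}$ such that every vertex $u$ with $f(u)=0$ has a neighbor $w$ with $f(w)=2$; its weight is $\sum_{u\in V}f(u)$; $\gamma_R(G)$ is the minimum weight of a Roman dominating function, and a $\gamma_R(G)$-function is a Roman dominating function of weight $\gamma_R(G)$. For $G$ with vertex set $\{v_1,\dots,v_n\}$ and $H$ with root $v$, the rooted product $G\circ H$ is obtained from one copy of $G$ and $n$ copies $H_1,\dots,H_n$ of $H$ by identifying each $v_i$ with the copy of $v$ in $H_i$. -}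

module Defs where

open import Data.Nat using (ℕ; _≤_; _+_)
import Data.Nat
open import Data.Fin using (Fin; toℕ; remQuot)
open import Data.Fin.Subset using (Subset; _∈_; ∣_∣)
open import Data.List using (tabulate)
open import Data.Nat.ListAction using (sum)
open import Data.Product using (Σ; ∃; ∃-syntax; _×_; _,_; proj₁; proj₂)
open import Data.Sum using (_⊎_; inj₁; inj₂)
open import Relation.Binary.PropositionalEquality using (_≡_; refl; sym; trans)
open import Relation.Nullary using (¬_)

record Graph : Set₁ where
  field
    order : ℕ
    Adj   : Fin order → Fin order → Set
    adjSym : ∀ {u w} → Adj u w → Adj w u
    adjIrrefl : ∀ {u} → ¬ Adj u u
open Graph public

Dominating : (G : Graph) → Subset (order G) → Set
Dominating G S = ∀ u → u ∈ S ⊎ (∃[ w ] (Adj G u w × w ∈ S))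

IsDominationNumber : Graph → ℕ → Set
IsDominationNumber G d =
  (∃[ S ] (Dominating G S × ∣ S ∣ ≡ d)) ×
  (∀ S → Dominating G S → d ≤ ∣ S ∣)

RomanDominating : (G : Graph) → (Fin (order G) → Fin 3) → Set
RomanDominating G f =
  ∀ u → f u ≡ Fin.zero → ∃[ w ] (Adj G u w × f w ≡ Fin.suc (Fin.suc Fin.zero))
  where import Data.Fin as Fin

weight : {n : ℕ} → (Fin n → Fin 3) → ℕ
weight f = sum (tabulate (λ u → toℕ (f u)))

IsRomanDominationNumber : Graph → ℕ → Set
IsRomanDominationNumber G k =
  (∃[ f ] (RomanDominating G f × weight f ≡ k)) ×
  (∀ f → RomanDominating G f → k ≤ weight f)

IsγRFunction : (G : Graph) → ℕ → (Fin (order G) → Fin 3) → Set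
IsγRFunction G k f = RomanDominating G f × weight f ≡ k

-- Rooted product G ∘ H with root v of H.
-- Vertex x of Fin (n * m) corresponds to (i , j) = remQuot m x : vertex j of copy H_i;
-- (i , v) is identified with vertex v_i of G.
RPAdj : (G H : Graph) (v : Fin (order H)) → Fin (order G) → Fin (order H) →
        Fin (order G) → Fin (order H) → Set
RPAdj G H v i j i' j' = (i ≡ i' × Adj H j j') ⊎ (j ≡ v × j' ≡ v × Adj G i i')

copy : {G H : Graph} → Fin (order G Data.Nat.* order H) → Fin (order G)
copy {G} {H} x = proj₁ (remQuot {order G} (order H) x)

pos : {G H : Graph} → Fin (order G Data.Nat.* order H) → Fin (order H)
pos {G} {H} x = proj₂ (remQuot {order G} (order H) x)

rootedProduct : (G H : Graph) → Fin (order H) → Graph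
rootedProduct G H v = record
  { order = order G Data.Nat.* order H
  ; Adj = λ x y → RPAdj G H v (copy {G} {H} x) (pos {G} {H} x) (copy {G} {H} y) (pos {G} {H} y)
  ; adjSym = λ { (inj₁ (e , a)) → inj₁ (sym e , Graph.adjSym H a)
            ; (inj₂ (e , e' , a)) → inj₂ (e' , e , Graph.adjSym G a) }
  ; adjIrrefl = λ { (inj₁ (_ , a)) → Graph.adjIrrefl H a
               ; (inj₂ (_ , _ , a)) → Graph.adjIrrefl G a } }

-- A Roman dominating function (RDF) f of G ∘ H cuts into n slices, one per
-- copy H_i.  Each slice is an RDF of H "away from the root": a 0 at a vertex
-- j ≢ v is covered inside H_i, while a 0 at the root may instead be covered by
-- a 2 on the root of a G-neighbouring copy.  Conversely, slices with these two
-- properties assemble into an RDF of G ∘ H, and the weight of f is the sum of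
-- the weights of its slices.
--
-- The key fact about H is that raising the root of an "RDF away from v" to a
-- non-zero value costs at most 1 and yields an RDF; so every slice has weight
-- at least γR(H) - 1, and at least γR(H) when its root is non-zero or has a
-- 2-neighbour in its copy.
--   (i)  If all γR(H)-functions vanish at v, a slice of weight < γR(H) would
--        raise to a γR(H)-function that does not vanish at v; so every slice
--        weighs ≥ γR(H), and n copies of one γR(H)-function attain n·γR(H).
--   (ii) The copies whose slice weighs ≥ γR(H) form a dominating set of G, so
--        the weight is ≥ n(γR(H)-1) + γ(G); a minimum dominating set S attains
--        it, using h' (with h'(v) = 2) on the copies in S and h with its root
--        cleared (weight γR(H)-1) on the others.
module Submission where

open import Defs
open import Data.Nat using (ℕ; _≤_; _*_; _+_; _∸_; zero; suc; z≤n; _≤?_)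
open import Data.Nat.Properties hiding (suc-injective; _≟_)
open import Data.Fin using (Fin; zero; suc; toℕ; combine; _↑ˡ_; _↑ʳ_)
open import Data.Fin.Properties using (remQuot-combine; combine-remQuot; suc-injective; _≟_)
open import Data.Fin.Subset using (Subset; ∣_∣) renaming (_∈_ to _∈ₛ_)
open import Data.Vec using ([]; _∷_; lookup) renaming (tabulate to vtabulate)
open import Data.Vec.Properties using ([]=⇒lookup; lookup⇒[]=; lookup∘tabulate)
open import Data.Vec.Functional using (updateAt)
open import Data.Vec.Functional.Properties using (updateAt-updates; updateAt-minimal)
open import Data.List using (tabulate)
open import Data.Nat.ListAction using (sum)
open import Data.Bool using (Bool; true; false)
open import Data.Product using (_×_; ∃-syntax; _,_; proj₁; proj₂)
open import Data.Sum using (_⊎_; inj₁; inj₂)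
open import Function using (_∘_)
open import Relation.Nullary using (Dec; yes; no; does; contradiction)
open import Relation.Nullary.Decidable using (dec-true)
open import Relation.Binary.PropositionalEquality
open import Algebra.Properties.CommutativeSemigroup +-commutativeSemigroup using (interchange)

Two : Fin 3
Two = suc (suc zero)

≡Two⇒≢0 : ∀ {x : Fin 3} → x ≡ Two → x ≢ zero
≡Two⇒≢0 refl ()

∑ : ∀ {n} → (Fin n → ℕ) → ℕ
∑ a = sum (tabulate a)

∑-cong : ∀ {n} {a b : Fin n → ℕ} → (∀ i → a i ≡ b i) → ∑ a ≡ ∑ b
∑-cong {zero}  eq = refl
∑-cong {suc n} eq = cong₂ _+_ (eq zero) (∑-cong (eq ∘ suc))

∑-mono : ∀ {n} {a b : Fin n → ℕ} → (∀ i → a i ≤ b i) → ∑ a ≤ ∑ b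
∑-mono {zero}  le = z≤n
∑-mono {suc n} le = +-mono-≤ (le zero) (∑-mono (le ∘ suc))

∑-const : ∀ {n} c → ∑ {n} (λ _ → c) ≡ n * c
∑-const {zero}  c = refl
∑-const {suc n} c = cong (c +_) (∑-const {n} c)

∑-+ : ∀ {n} (a b : Fin n → ℕ) → ∑ (λ i → a i + b i) ≡ ∑ a + ∑ b
∑-+ {zero}  a b = refl
∑-+ {suc n} a b = trans (cong (a zero + b zero +_) (∑-+ (a ∘ suc) (b ∘ suc)))
                        (interchange (a zero) (b zero) _ _)

∑-split : ∀ m {n} (a : Fin (m + n) → ℕ) →
          ∑ a ≡ ∑ (λ i → a (i ↑ˡ n)) + ∑ (λ j → a (m ↑ʳ j))
∑-split zero    a = refl
∑-split (suc m) a = trans (cong (a zero +_) (∑-split m (a ∘ suc))) (sym (+-assoc (a zero) _ _))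

∑-combine : ∀ m {n} (a : Fin (m * n) → ℕ) → ∑ a ≡ ∑ {m} (λ i → ∑ {n} (λ j → a (combine i j)))
∑-combine zero    a = refl
∑-combine (suc m) {n} a =
  trans (∑-split n a) (cong (∑ (λ j → a (combine {suc m} zero j)) +_) (∑-combine m (λ x → a (n ↑ʳ x))))

∑-update : ∀ {n} (a b : Fin n → ℕ) v → (∀ j → j ≢ v → a j ≡ b j) → ∑ a + b v ≡ ∑ b + a v
∑-update a b zero agree = begin
  a zero + ∑ (a ∘ suc) + b zero  ≡⟨ cong (λ r → a zero + r + b zero) (∑-cong λ j → agree (suc j) λ ()) ⟩
  a zero + r + b zero            ≡⟨ +-comm (a zero + r) (b zero) ⟩
  b zero + (a zero + r)          ≡⟨ cong (b zero +_) (+-comm (a zero) r) ⟩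
  b zero + (r + a zero)          ≡⟨ sym (+-assoc (b zero) r (a zero)) ⟩
  b zero + r + a zero            ∎
  where
  open ≡-Reasoning
  r : ℕ
  r = ∑ (b ∘ suc)
∑-update a b (suc v) agree = begin
  a zero + ∑ (a ∘ suc) + b (suc v)    ≡⟨ +-assoc (a zero) _ _ ⟩
  a zero + (∑ (a ∘ suc) + b (suc v))  ≡⟨ cong₂ _+_ (agree zero λ ()) (∑-update (a ∘ suc) (b ∘ suc) v agree′) ⟩
  b zero + (∑ (b ∘ suc) + a (suc v))  ≡⟨ sym (+-assoc (b zero) _ _) ⟩
  b zero + ∑ (b ∘ suc) + a (suc v)    ∎
  where
  open ≡-Reasoning
  agree′ : ∀ j → j ≢ v → a (suc j) ≡ b (suc j)
  agree′ j j≢v = agree (suc j) (j≢v ∘ suc-injective)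

weight-updateAt : ∀ {n} (g : Fin n → Fin 3) v t →
                  weight (updateAt g v t) + toℕ (g v) ≡ weight g + toℕ (t (g v))
weight-updateAt g v t =
  trans (∑-update (toℕ ∘ updateAt g v t) (toℕ ∘ g) v (λ j j≢v → cong toℕ (updateAt-minimal j v g j≢v)))
        (cong (λ x → weight g + toℕ x) (updateAt-updates v g))

indicator : Bool → ℕ
indicator true  = 1
indicator false = 0

∣∣≡∑indicator : ∀ {n} (S : Subset n) → ∣ S ∣ ≡ ∑ (λ i → indicator (lookup S i))
∣∣≡∑indicator []          = refl
∣∣≡∑indicator (true ∷ S)  = cong suc (∣∣≡∑indicator S)
∣∣≡∑indicator (false ∷ S) = ∣∣≡∑indicator S

module Pinned (H : Graph) (v : Fin (order H)) where

  RomanDominatingOff : (Fin (order H) → Fin 3) → Set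
  RomanDominatingOff g = ∀ j → g j ≡ zero → (∃[ w ] (Adj H j w × g w ≡ Two)) ⊎ j ≡ v

  RootCovered : (Fin (order H) → Fin 3) → Set
  RootCovered g = g v ≡ zero → ∃[ w ] (Adj H v w × g w ≡ Two)

  nonzero-root-covered : ∀ {g} → g v ≢ zero → RootCovered g
  nonzero-root-covered gv≢0 gv≡0 = contradiction gv≡0 gv≢0

  rdf⇒off : ∀ {g} → RomanDominating H g → RomanDominatingOff g
  rdf⇒off rdf j gj≡0 = inj₁ (rdf j gj≡0)

  off⇒rdf : ∀ {g} → RomanDominatingOff g → RootCovered g → RomanDominating H g
  off⇒rdf off covered j gj≡0 with off j gj≡0
  ... | inj₁ twoNeighbour = twoNeighbour
  ... | inj₂ refl         = covered gj≡0

  atLeastOne : Fin 3 → Fin 3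
  atLeastOne zero    = suc zero
  atLeastOne (suc x) = suc x

  atLeastOne-nonzero : ∀ x → atLeastOne x ≢ zero
  atLeastOne-nonzero zero    ()
  atLeastOne-nonzero (suc x) ()

  atLeastOne-fixes : ∀ {x} → x ≢ zero → atLeastOne x ≡ x
  atLeastOne-fixes {zero}  x≢0 = contradiction refl x≢0
  atLeastOne-fixes {suc x} _   = refl

  atLeastOne-≤ : ∀ x → toℕ (atLeastOne x) ≤ suc (toℕ x)
  atLeastOne-≤ zero    = ≤-refl
  atLeastOne-≤ (suc x) = n≤1+n _

  raise : (Fin (order H) → Fin 3) → Fin (order H) → Fin 3
  raise g = updateAt g v atLeastOne

  raise-root : ∀ g → raise g v ≢ zero
  raise-root g = atLeastOne-nonzero (g v) ∘ trans (sym (updateAt-updates v g))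

  raise-keeps : ∀ g j → g j ≢ zero → raise g j ≡ g j
  raise-keeps g j gj≢0 with j ≟ v
  ... | yes refl = trans (updateAt-updates v g) (atLeastOne-fixes gj≢0)
  ... | no j≢v   = updateAt-minimal j v g j≢v

  raise-rdf : ∀ {g} → RomanDominatingOff g → RomanDominating H (raise g)
  raise-rdf {g} off j raised≡0 with j ≟ v
  ... | yes refl = contradiction raised≡0 (raise-root g)
  ... | no j≢v with off j (trans (sym (updateAt-minimal j v g j≢v)) raised≡0)
  ...   | inj₂ j≡v            = contradiction j≡v j≢v
  ...   | inj₁ (w , adj , gw≡2) = w , adj , trans (raise-keeps g w (≡Two⇒≢0 gw≡2)) gw≡2

  raise-weight : ∀ g → weight (raise g) ≤ suc (weight g)
  raise-weight g = +-cancelʳ-≤ (toℕ (g v)) (weight (raise g)) (suc (weight g)) (begin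
    weight (raise g) + toℕ (g v)       ≡⟨ weight-updateAt g v atLeastOne ⟩
    weight g + toℕ (atLeastOne (g v))  ≤⟨ +-monoʳ-≤ (weight g) (atLeastOne-≤ (g v)) ⟩
    weight g + suc (toℕ (g v))         ≡⟨ +-suc (weight g) (toℕ (g v)) ⟩
    suc (weight g) + toℕ (g v)         ∎)
    where open ≤-Reasoning

  clear : (Fin (order H) → Fin 3) → Fin (order H) → Fin 3
  clear g = updateAt g v (λ _ → zero)

  clear-off : ∀ {g} → RomanDominating H g → g v ≢ Two → RomanDominatingOff (clear g)
  clear-off {g} rdf gv≢2 j cleared≡0 with j ≟ v
  ... | yes j≡v = inj₂ j≡v
  ... | no j≢v with rdf j (trans (sym (updateAt-minimal j v g j≢v)) cleared≡0)
  ...   | w , adj , gw≡2 = inj₁ (w , adj , trans (updateAt-minimal w v g w≢v) gw≡2)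
    where w≢v : w ≢ v
          w≢v refl = gv≢2 gw≡2

  clear-weight : ∀ g → weight (clear g) + toℕ (g v) ≡ weight g
  clear-weight g = trans (weight-updateAt g v (λ _ → zero)) (+-identityʳ (weight g))

  module _ {k : ℕ} (γR : IsRomanDominationNumber H k) where

    -- Raising costs at most 1, so an RDF away from v weighs at least k - 1.
    off-weight≥ : ∀ {g} → RomanDominatingOff g → k ∸ 1 ≤ weight g
    off-weight≥ {g} off = ∸-monoˡ-≤ 1 (≤-trans (proj₂ γR (raise g) (raise-rdf off)) (raise-weight g))

    covered-weight≥ : ∀ {g} → RomanDominatingOff g → RootCovered g → k ≤ weight g
    covered-weight≥ {g} off covered = proj₂ γR g (off⇒rdf off covered)

    -- If every γR(H)-function vanishes at v, an RDF away from v weighs at least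
    -- k: otherwise raising it would give a γR(H)-function non-zero at v.
    off-weight≥-vanishing : (∀ f → IsγRFunction H k f → f v ≡ zero) →
                            ∀ {g} → RomanDominatingOff g → k ≤ weight g
    off-weight≥-vanishing vanish {g} off with k ≤? weight g
    ... | yes k≤w = k≤w
    ... | no k≰w  = contradiction (vanish (raise g) (raise-rdf off , weight≡k)) (raise-root g)
      where
      weight≡k : weight (raise g) ≡ k
      weight≡k = ≤-antisym (≤-trans (raise-weight g) (≰⇒> k≰w)) (proj₂ γR (raise g) (raise-rdf off))

module RootedProduct (G H : Graph) (v : Fin (order H)) where
  open Pinned H v

  P : Graph
  P = rootedProduct G H v

  copyOf : Fin (order P) → Fin (order G)
  copyOf = copy {G} {H}

  posOf : Fin (order P) → Fin (order H)
  posOf = pos {G} {H}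

  copy-combine : ∀ i j → copyOf (combine i j) ≡ i
  copy-combine i j = cong proj₁ (remQuot-combine {order G} {order H} i j)

  pos-combine : ∀ i j → posOf (combine i j) ≡ j
  pos-combine i j = cong proj₂ (remQuot-combine {order G} {order H} i j)

  combine-copy-pos : ∀ x → combine (copyOf x) (posOf x) ≡ x
  combine-copy-pos x = combine-remQuot {order G} (order H) x

  slice : (Fin (order P) → Fin 3) → Fin (order G) → Fin (order H) → Fin 3
  slice f i j = f (combine i j)

  assemble : (Fin (order G) → Fin (order H) → Fin 3) → Fin (order P) → Fin 3
  assemble φ x = φ (copyOf x) (posOf x)

  assemble-combine : ∀ φ i j → assemble φ (combine i j) ≡ φ i j
  assemble-combine φ i j = cong₂ φ (copy-combine i j) (pos-combine i j)

  slice-at : ∀ f {i j} y → i ≡ copyOf y → j ≡ posOf y → slice f i j ≡ f y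
  slice-at f y refl refl = cong f (combine-copy-pos y)

  weight-slices : ∀ f → weight f ≡ ∑ (λ i → weight (slice f i))
  weight-slices f = ∑-combine (order G) (toℕ ∘ f)

  weight-assemble : ∀ φ → weight (assemble φ) ≡ ∑ (λ i → weight (φ i))
  weight-assemble φ =
    trans (weight-slices (assemble φ)) (∑-cong λ i → ∑-cong λ j → cong toℕ (assemble-combine φ i j))

  RootCoveredAcross : (Fin (order G) → Fin (order H) → Fin 3) → Fin (order G) → Set
  RootCoveredAcross φ i =
    φ i v ≡ zero → (∃[ w ] (Adj H v w × φ i w ≡ Two)) ⊎ (∃[ i′ ] (Adj G i i′ × φ i′ v ≡ Two))

  slice-dominated : ∀ {f} → RomanDominating P f → ∀ {i j} → slice f i j ≡ zero →
                    (∃[ w ] (Adj H j w × slice f i w ≡ Two)) ⊎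
                    (j ≡ v × ∃[ i′ ] (Adj G i i′ × slice f i′ v ≡ Two))
  slice-dominated {f} rdf {i} {j} fij≡0 with rdf (combine i j) fij≡0
  ... | y , inj₁ (sameCopy , adj) , fy≡2 =
    inj₁ (posOf y , subst (λ j₀ → Adj H j₀ (posOf y)) (pos-combine i j) adj ,
          trans (slice-at f y (trans (sym (copy-combine i j)) sameCopy) refl) fy≡2)
  ... | y , inj₂ (atRoot , yAtRoot , adj) , fy≡2 =
    inj₂ (trans (sym (pos-combine i j)) atRoot , copyOf y ,
          subst (λ i₀ → Adj G i₀ (copyOf y)) (copy-combine i j) adj ,
          trans (slice-at f y refl (sym yAtRoot)) fy≡2)

  slice-off : ∀ {f} → RomanDominating P f → ∀ i → RomanDominatingOff (slice f i)
  slice-off rdf i j fij≡0 with slice-dominated rdf fij≡0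
  ... | inj₁ twoNeighbour     = inj₁ twoNeighbour
  ... | inj₂ (atRoot , _)     = inj₂ atRoot

  slice-root : ∀ {f} → RomanDominating P f → ∀ i → RootCoveredAcross (slice f) i
  slice-root rdf i fiv≡0 with slice-dominated rdf fiv≡0
  ... | inj₁ twoNeighbour     = inj₁ twoNeighbour
  ... | inj₂ (_ , acrossRoot) = inj₂ acrossRoot

  adj-inCopy : ∀ x {w} → Adj H (posOf x) w → Adj P x (combine (copyOf x) w)
  adj-inCopy x {w} adj = inj₁ (sym (copy-combine _ w) , subst (Adj H (posOf x)) (sym (pos-combine _ w)) adj)

  adj-acrossRoot : ∀ x {i′} → posOf x ≡ v → Adj G (copyOf x) i′ → Adj P x (combine i′ v)
  adj-acrossRoot x {i′} atRoot adj =
    inj₂ (atRoot , pos-combine i′ v , subst (Adj G (copyOf x)) (sym (copy-combine i′ v)) adj)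

  assemble-rdf : ∀ φ → (∀ i → RomanDominatingOff (φ i)) → (∀ i → RootCoveredAcross φ i) →
                 RomanDominating P (assemble φ)
  assemble-rdf φ off root x φx≡0 with off (copyOf x) (posOf x) φx≡0
  ... | inj₁ (w , adj , two) = combine (copyOf x) w , adj-inCopy x adj , trans (assemble-combine φ _ w) two
  ... | inj₂ atRoot with root (copyOf x) (subst (λ j → φ (copyOf x) j ≡ zero) atRoot φx≡0)
  ...   | inj₁ (w , adj , two) =
    combine (copyOf x) w , adj-inCopy x (subst (λ j → Adj H j w) (sym atRoot) adj) , trans (assemble-combine φ _ w) two
  ...   | inj₂ (i′ , adj , two) =
    combine i′ v , adj-acrossRoot x atRoot adj , trans (assemble-combine φ i′ v) two

module Cases (G H : Graph) (v : Fin (order H)) {k : ℕ} (γR : IsRomanDominationNumber H k) where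
  open Pinned H v
  open RootedProduct G H v

  n : ℕ
  n = order G

  copies-rdf : ∀ {g} → RomanDominating H g → RomanDominating P (assemble (λ _ → g))
  copies-rdf {g} rdf = assemble-rdf (λ _ → g) (λ _ → rdf⇒off rdf) (λ _ gv≡0 → inj₁ (rdf v gv≡0))

  copies-weight : ∀ g → weight (assemble (λ _ → g)) ≡ n * weight g
  copies-weight g = trans (weight-assemble (λ _ → g)) (∑-const {n} (weight g))

  vanishing-lower : (∀ f → IsγRFunction H k f → f v ≡ zero) →
                    ∀ f → RomanDominating P f → n * k ≤ weight f
  vanishing-lower vanish f rdf = begin
    n * k                         ≡⟨ sym (∑-const {n} k) ⟩
    ∑ {n} (λ _ → k)               ≤⟨ ∑-mono (λ i → off-weight≥-vanishing γR vanish (slice-off rdf i)) ⟩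
    ∑ (λ i → weight (slice f i))  ≡⟨ sym (weight-slices f) ⟩
    weight f                      ∎
    where open ≤-Reasoning

  vanishing-case : (∀ f → IsγRFunction H k f → f v ≡ zero) → IsRomanDominationNumber P (n * k)
  vanishing-case vanish with proj₁ γR
  ... | g , rdf , weight≡k =
    (assemble (λ _ → g) , copies-rdf rdf , trans (copies-weight g) (cong (n *_) weight≡k)) ,
    vanishing-lower vanish

  baseline : (B : Subset n) → ∑ (λ i → (k ∸ 1) + indicator (lookup B i)) ≡ n * (k ∸ 1) + ∣ B ∣
  baseline B = trans (∑-+ (λ _ → k ∸ 1) (λ i → indicator (lookup B i)))
                     (cong₂ _+_ (∑-const {n} (k ∸ 1)) (sym (∣∣≡∑indicator B)))

  -- Every slice weighs ≥ k - 1, and the heavy copies T (slice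
  -- weight ≥ k) dominate G: a light copy has a 0 at its root not covered in
  -- its own copy, so a neighbouring copy has a 2 at its root and is heavy.
  heavy-lower : 1 ≤ k → ∀ {d} → (∀ S → Dominating G S → d ≤ ∣ S ∣) →
                ∀ f → RomanDominating P f → n * (k ∸ 1) + d ≤ weight f
  heavy-lower k≥1 {d} dMin f rdf = begin
    n * (k ∸ 1) + d                                ≤⟨ +-monoʳ-≤ (n * (k ∸ 1)) (dMin T T-dominating) ⟩
    n * (k ∸ 1) + ∣ T ∣                            ≡⟨ sym (baseline T) ⟩
    ∑ (λ i → (k ∸ 1) + indicator (lookup T i))    ≤⟨ ∑-mono per-copy ⟩
    ∑ (λ i → weight (slice f i))                   ≡⟨ sym (weight-slices f) ⟩
    weight f                                       ∎
    where
    open ≤-Reasoning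
    heavy : Fin n → Bool
    heavy i = does (k ≤? weight (slice f i))

    T : Subset n
    T = vtabulate heavy

    heavy-∈ : ∀ {i} → k ≤ weight (slice f i) → i ∈ₛ T
    heavy-∈ {i} k≤w = lookup⇒[]= i T (trans (lookup∘tabulate heavy i) (dec-true (k ≤? _) k≤w))

    per-copy : ∀ i → (k ∸ 1) + indicator (lookup T i) ≤ weight (slice f i)
    per-copy i rewrite lookup∘tabulate heavy i = bound (k ≤? weight (slice f i))
      where
      bound : (k≤?w : Dec (k ≤ weight (slice f i))) → (k ∸ 1) + indicator (does k≤?w) ≤ weight (slice f i)
      bound (yes k≤w) = ≤-trans (≤-reflexive (m∸n+n≡m k≥1)) k≤w
      bound (no _)    = ≤-trans (≤-reflexive (+-identityʳ (k ∸ 1))) (off-weight≥ γR (slice-off rdf i))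

    covered-heavy : ∀ i → RootCovered (slice f i) → k ≤ weight (slice f i)
    covered-heavy i = covered-weight≥ γR (slice-off rdf i)

    T-dominating : Dominating G T
    T-dominating u with k ≤? weight (slice f u)
    ... | yes k≤w = inj₁ (heavy-∈ k≤w)
    ... | no light with slice f u v ≟ zero
    ...   | no fuv≢0 = contradiction (covered-heavy u (nonzero-root-covered fuv≢0)) light
    ...   | yes fuv≡0 with slice-root rdf u fuv≡0
    ...     | inj₁ twoNeighbour = contradiction (covered-heavy u (λ _ → twoNeighbour)) light
    ...     | inj₂ (i′ , adj , fi′v≡2) =
      inj₂ (i′ , adj , heavy-∈ (covered-heavy i′ (nonzero-root-covered (≡Two⇒≢0 fi′v≡2))))

  module Mixed (h h′ : Fin (order H) → Fin 3) (S : Subset n) where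

    pick : Bool → Fin (order H) → Fin 3
    pick true  = h′
    pick false = clear h

    mixed : Fin n → Fin (order H) → Fin 3
    mixed i = pick (lookup S i)

    mixed-rdf : RomanDominating H h → h v ≢ Two → RomanDominating H h′ → h′ v ≡ Two →
                Dominating G S → RomanDominating P (assemble mixed)
    mixed-rdf rdf hv≢2 rdf′ h′v≡2 dom = assemble-rdf mixed off root
      where
      off : ∀ i → RomanDominatingOff (mixed i)
      off i with lookup S i
      ... | true  = rdf⇒off rdf′
      ... | false = clear-off rdf hv≢2

      root : ∀ i → RootCoveredAcross mixed i
      root i mixed≡0 with lookup S i in i∈?S
      ... | true  = inj₁ (rdf′ v mixed≡0)
      ... | false with dom i
      ...   | inj₁ i∈S = contradiction (trans (sym ([]=⇒lookup i∈S)) i∈?S) λ ()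
      ...   | inj₂ (i′ , adj , i′∈S) =
        inj₂ (i′ , adj , trans (cong (λ b → pick b v) ([]=⇒lookup i′∈S)) h′v≡2)

    mixed-weight : weight h′ ≡ k → weight (clear h) ≡ k ∸ 1 → k ∸ 1 + 1 ≡ k →
                   weight (assemble mixed) ≡ n * (k ∸ 1) + ∣ S ∣
    mixed-weight wh′ wClear k-1+1 = trans (weight-assemble mixed) (trans (∑-cong per-copy) (baseline S))
      where
      per-copy : ∀ i → weight (mixed i) ≡ (k ∸ 1) + indicator (lookup S i)
      per-copy i with lookup S i
      ... | true  = trans wh′ (sym k-1+1)
      ... | false = trans wClear (sym (+-identityʳ (k ∸ 1)))

  dominating-case : (∃[ h ] ∃[ h′ ] (IsγRFunction H k h × h v ≡ suc zero × IsγRFunction H k h′ × h′ v ≡ Two)) →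
                    ∀ d → IsDominationNumber G d → IsRomanDominationNumber P (n * (k ∸ 1) + d)
  dominating-case (h , h′ , (rdf , wh) , hv≡1 , (rdf′ , wh′) , h′v≡2) d ((S , dom , ∣S∣≡d) , dMin) =
    (assemble mixed , mixed-rdf rdf (λ hv≡2 → one≢two (trans (sym hv≡1) hv≡2)) rdf′ h′v≡2 dom ,
       trans (mixed-weight wh′ wClear (m∸n+n≡m k≥1)) (cong (n * (k ∸ 1) +_) ∣S∣≡d)) ,
    heavy-lower k≥1 dMin
    where
    open Mixed h h′ S
    one≢two : suc zero ≢ Two
    one≢two ()
    -- h v = 1, so clearing the root of h lowers its weight k by exactly 1.
    wClear+1 : weight (clear h) + 1 ≡ k
    wClear+1 = trans (cong (λ x → weight (clear h) + toℕ x) (sym hv≡1)) (trans (clear-weight h) wh)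
    wClear : weight (clear h) ≡ k ∸ 1
    wClear = trans (sym (m+n∸n≡m (weight (clear h)) 1)) (cong (_∸ 1) wClear+1)
    k≥1 : 1 ≤ k
    k≥1 = subst (1 ≤_) wClear+1 (m≤n+m 1 _)

mainTheorem3 : (G H : Graph) (v : Fin (order H)) →
    2 ≤ order G → 2 ≤ order H →
    ∀ (k : ℕ) → IsRomanDominationNumber H k →
      ((∀ f → IsγRFunction H k f → f v ≡ zero) →
         IsRomanDominationNumber (rootedProduct G H v) (order G * k))
      × ((∃[ h ] ∃[ h' ] (IsγRFunction H k h × h v ≡ suc zero × IsγRFunction H k h' × h' v ≡ suc (suc zero))) →
         ∀ (d : ℕ) → IsDominationNumber G d →
         IsRomanDominationNumber (rootedProduct G H v) (order G * (k ∸ 1) + d))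
mainTheorem3 G H v _ _ k γR = vanishing-case , dominating-case
  where open Cases G H v γR
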